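{- Let $m_1,m_2,m_3$ and $n$ be integers greater than $2$. Then the following are equivalent: (i) $\bar{R}(m_1,m_2,m_3)\le n$; (ii) for any two Ramsey $(m_3,m_2)$-graphs $G$ and $H$ on the vertex set $[n]$ such that $H$ is a subgraph of $G$ (i.e. $E(H)\subseteq E(G)$), one has $\alpha(G\setminus H)\ge m_1$.
   Context: $[n]=\{1,\dots,n\}$. An edge-coloring of $K_n$ with $k$ colors is a map $f:\binom{[n]}{2}\to[k]$; $\alpha_i(f)$ is the independence number of the graph on $[n]$ whose edges are the pairs of color $i$. $\bar{R}(m_1,\dots,m_k)$ is the least positive integer $n$ such that every edge-coloring $f$ of $K_n$ with $k$ colors has some $i$ with $\alpha_i(f)\ge m_i$. A graph $G$ is a Ramsey $(s,t)$-graph if $\omega(G)<s$ and $\alpha(G)<t$, where $\omega,\alpha$ denote clique and independence numbers. For a graph $G$ and a subgraph $H$, $G\setminus H$ denotes the graph $(V(G),E(G)\setminus E(H))$. -}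

module Defs where

open import Data.Nat using (ℕ; _≤_; _<_; suc)
open import Data.Fin using (Fin; zero; suc)
open import Data.Fin.Subset using (Subset; _∈_; ∣_∣)
open import Data.Bool using (Bool; true; false; _∧_; not)
open import Data.Product using (Σ; ∃; _×_; _,_)
open import Relation.Binary.PropositionalEquality using (_≡_; _≢_)
open import Relation.Nullary using (¬_)

record Graph (n : ℕ) : Set where
  field
    adj    : Fin n → Fin n → Bool
    sym    : ∀ x y → adj x y ≡ adj y x
    irrefl : ∀ x → adj x x ≡ false
open Graph public

Edge : ∀ {n} → Graph n → Fin n → Fin n → Set
Edge G x y = adj G x y ≡ true

IsIndependent : ∀ {n} → (Fin n → Fin n → Set) → Subset n → Set
IsIndependent E S = ∀ x y → x ∈ S → y ∈ S → x ≢ y → ¬ E x y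

IsClique : ∀ {n} → (Fin n → Fin n → Set) → Subset n → Set
IsClique E S = ∀ x y → x ∈ S → y ∈ S → x ≢ y → E x y

αAtLeast : ∀ {n} → (Fin n → Fin n → Set) → ℕ → Set
αAtLeast E m = Σ (Subset _) λ S → IsIndependent E S × m ≤ ∣ S ∣

ωAtLeast : ∀ {n} → (Fin n → Fin n → Set) → ℕ → Set
ωAtLeast E m = Σ (Subset _) λ S → IsClique E S × m ≤ ∣ S ∣

IsRamseyGraph : ∀ {n} → ℕ → ℕ → Graph n → Set
IsRamseyGraph s t G = ¬ ωAtLeast (Edge G) s × ¬ αAtLeast (Edge G) t

IsSubgraph : ∀ {n} → Graph n → Graph n → Set
IsSubgraph H G = ∀ x y → Edge H x y → Edge G x y

_∖_ : ∀ {n} → Graph n → Graph n → Graph n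
_∖_ {n} G H = record
  { adj = λ x y → adj G x y ∧ not (adj H x y)
  ; sym = λ x y → symm x y
  ; irrefl = λ x → irr x }
  where
  open import Relation.Binary.PropositionalEquality using (cong₂; refl)
  symm : ∀ x y → (adj G x y ∧ not (adj H x y)) ≡ (adj G y x ∧ not (adj H y x))
  symm x y = cong₂ (λ a b → a ∧ not b) (Graph.sym G x y) (Graph.sym H x y)
  irr : ∀ x → (adj G x x ∧ not (adj H x x)) ≡ false
  irr x with adj G x x | Graph.irrefl G x
  ... | .false | refl = refl

-- An edge-coloring of K_n with k colors: a color for each unordered pair,
-- represented as a symmetric function on ordered pairs (diagonal ignored).
record Coloring (n k : ℕ) : Set where
  field
    col    : Fin n → Fin n → Fin k
    colSym : ∀ x y → col x y ≡ col y x
open Coloring public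

ColorEdge : ∀ {n k} → Coloring n k → Fin k → Fin n → Fin n → Set
ColorEdge f i x y = x ≢ y × col f x y ≡ i

RamseyProp : (k : ℕ) → (Fin k → ℕ) → ℕ → Set
RamseyProp k m n = (f : Coloring n k) → ∃ λ i → αAtLeast (ColorEdge f i) (m i)

IsRbar : (k : ℕ) → (Fin k → ℕ) → ℕ → Set
IsRbar k m r = 1 ≤ r × RamseyProp k m r × (∀ r′ → 1 ≤ r′ → RamseyProp k m r′ → r ≤ r′)

triple : ℕ → ℕ → ℕ → Fin 3 → ℕ
triple a b c zero = a
triple a b c (suc zero) = b
triple a b c (suc (suc zero)) = c

-- A 3-colouring f of K_n and a nested pair H ⊆ G of graphs on [n] are two views of the same
-- data: H is colour class 1, G is the complement of colour class 2, and G ∖ H is colour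
-- class 0.  Under this correspondence α(H) = α₁(f), ω(G) = α₂(f) and α(G ∖ H) = α₀(f),
-- while α(G) ≤ α(H) and ω(H) ≤ ω(G); so (ii) says exactly that every 3-colouring of K_n
-- has some αᵢ(f) ≥ mᵢ.  That property is decidable and upward closed in n, so it holds at n
-- iff its least witness R̄(m₁, m₂, m₃) exists and is at most n.
module Submission where

open import Defs
open import Data.Nat using (ℕ; _≤_; _<_)
open import Data.Product using (Σ; ∃; _×_)
open import Function.Bundles using (_⇔_)

open import Data.Bool using (Bool; true; false; _∧_; not)
open import Data.Bool.Properties using (¬-not)
open import Data.Empty using (⊥-elim)
open import Data.Fin using (Fin; suc; _≟_)
open import Data.Fin.Patterns using (0F; 1F; 2F)
open import Data.Fin.Properties using (all?; any?)
open import Data.Fin.Subset using (∣_∣; outside)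
open import Data.Fin.Subset.Properties using (_∈?_; anySubset?)
open import Data.Nat using (suc; zero; z≤n; s≤s; _≤′_; ≤′-refl; ≤′-step; _≤?_)
open import Data.Nat.Properties using (≤-refl; ≤-trans; <-≤-trans; m≤n⇒m≤1+n; ≮⇒≥; ≤⇒≤′; anyUpTo?)
open import Data.Product using (_,_; proj₂)
open import Data.Vec using (Vec; []; _∷_; lookup; tabulate; here; there)
open import Data.Vec.Properties using (lookup∘tabulate)
open import Function.Bundles using (mk⇔; Equivalence)
open import Level using (0ℓ)
open import Relation.Binary.Definitions using (Decidable; Symmetric)
open import Relation.Binary.PropositionalEquality
  using (_≡_; _≢_; refl; trans; cong; cong₂; ≢-sym) renaming (sym to ≡-sym)
open import Relation.Nullary using (¬_; Dec; yes; no; does; contradiction)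
open import Relation.Nullary.Decidable using (_×-dec_; _→-dec_; ¬?; dec-true; dec-false; does-⇔)
import Relation.Nullary.Decidable as Dec
open import Relation.Unary using (Pred) renaming (Decidable to Decidable₁)

private
  variable
    k n m : ℕ

α-mono : {E E′ : Fin n → Fin n → Set} → (∀ x y → E′ x y → E x y) →
         αAtLeast E m → αAtLeast E′ m
α-mono E′⊆E (S , indep , size) =
  S , (λ x y x∈S y∈S x≢y e → indep x y x∈S y∈S x≢y (E′⊆E x y e)) , size

ω-mono : {E E′ : Fin n → Fin n → Set} → (∀ x y → E x y → E′ x y) →
         ωAtLeast E m → ωAtLeast E′ m
ω-mono E⊆E′ (S , clique , size) =
  S , (λ x y x∈S y∈S x≢y → E⊆E′ x y (clique x y x∈S y∈S x≢y)) , size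

ω⇒α-disjoint : {E E′ : Fin n → Fin n → Set} → (∀ x y → E x y → ¬ E′ x y) →
               ωAtLeast E m → αAtLeast E′ m
ω⇒α-disjoint disjoint (S , clique , size) =
  S , (λ x y x∈S y∈S x≢y → disjoint x y (clique x y x∈S y∈S x≢y)) , size

α⇒ω-covering : {E E′ : Fin n → Fin n → Set} → (∀ x y → x ≢ y → ¬ E′ x y → E x y) →
               αAtLeast E′ m → ωAtLeast E m
α⇒ω-covering covering (S , indep , size) =
  S , (λ x y x∈S y∈S x≢y → covering x y x≢y (indep x y x∈S y∈S x≢y)) , size

isIndependent? : {E : Fin n → Fin n → Set} → Decidable E → Decidable₁ (IsIndependent E)
isIndependent? E? S =
  all? λ x → all? λ y → x ∈? S →-dec (y ∈? S →-dec (¬? (x ≟ y) →-dec ¬? (E? x y)))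

αAtLeast? : {E : Fin n → Fin n → Set} → Decidable E → Decidable₁ (αAtLeast E)
αAtLeast? E? m = anySubset? λ S → isIndependent? E? S ×-dec (m ≤? ∣ S ∣)

colorEdge? : (f : Coloring n k) (i : Fin k) → Decidable (ColorEdge f i)
colorEdge? f i x y = ¬? (x ≟ y) ×-dec (col f x y ≟ i)

Searchable : Set → Set₁
Searchable A = {P : Pred A 0ℓ} → Decidable₁ P → Dec (∀ a → P a)

Fin-searchable : Searchable (Fin k)
Fin-searchable = all?

Vec-searchable : {A : Set} → Searchable A → Searchable (Vec A n)
Vec-searchable {n = zero}  search P? = Dec.map′ (λ { p [] → p }) (λ p → p []) (P? [])
Vec-searchable {n = suc n} search P? =
  Dec.map′ (λ { p (a ∷ v) → p a v }) (λ p a v → p (a ∷ v))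
           (search λ a → Vec-searchable search λ v → P? (a ∷ v))

-- RamseyProp depends on a colouring only through its colour function.
HasIndependentColourClass : (Fin n → Fin n → Fin k) → (Fin k → ℕ) → Set
HasIndependentColourClass c m = ∃ λ i → αAtLeast (λ x y → x ≢ y × c x y ≡ i) (m i)

HasIndependentColourClass-cong : {c c′ : Fin n → Fin n → Fin k} {m : Fin k → ℕ} →
  (∀ x y → c x y ≡ c′ x y) → HasIndependentColourClass c m → HasIndependentColourClass c′ m
HasIndependentColourClass-cong c≗c′ (i , α) =
  i , α-mono (λ x y (x≢y , c′≡i) → x≢y , trans (c≗c′ x y) c′≡i) α

entry : Vec (Vec (Fin k) n) n → Fin n → Fin n → Fin k
entry M x y = lookup (lookup M x) y

entry-tabulate : (c : Fin n → Fin n → Fin k) →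
                 ∀ x y → entry (tabulate (λ x → tabulate (c x))) x y ≡ c x y
entry-tabulate c x y rewrite lookup∘tabulate (λ x → tabulate (c x)) x = lookup∘tabulate (c x) y

-- A predicate on colour functions need not respect pointwise equality, so colourings are
-- searched through their colour matrices instead.
RamseyProp? : ∀ k m n → Dec (RamseyProp k m n)
RamseyProp? k m n = Dec.map′ fromMatrices toMatrices
  (Vec-searchable (Vec-searchable Fin-searchable) λ M → symmetric? M →-dec hasClass? M)
  where
  symmetric? : ∀ M → Dec (∀ x y → entry M x y ≡ entry M y x)
  symmetric? M = all? λ x → all? λ y → entry M x y ≟ entry M y x

  hasClass? : ∀ M → Dec (HasIndependentColourClass (entry M) m)
  hasClass? M = any? λ i → αAtLeast? (λ x y → ¬? (x ≟ y) ×-dec (entry M x y ≟ i)) (m i)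

  fromMatrices : (∀ M → (∀ x y → entry M x y ≡ entry M y x) →
                       HasIndependentColourClass (entry M) m) →
                 RamseyProp k m n
  fromMatrices all f = HasIndependentColourClass-cong (entry-tabulate (col f)) (all M M-sym)
    where
    M = tabulate (λ x → tabulate (col f x))
    M-sym : ∀ x y → entry M x y ≡ entry M y x
    M-sym x y = trans (entry-tabulate (col f) x y)
                      (trans (colSym f x y) (≡-sym (entry-tabulate (col f) y x)))

  toMatrices : RamseyProp k m n →
               ∀ M → (∀ x y → entry M x y ≡ entry M y x) → HasIndependentColourClass (entry M) m
  toMatrices rp M M-sym = rp record { col = entry M ; colSym = M-sym }

RamseyProp-suc : {m : Fin k → ℕ} → RamseyProp k m n → RamseyProp k m (suc n)
RamseyProp-suc rp f
  with rp record { col = λ x y → col f (suc x) (suc y) ; colSym = λ x y → colSym f (suc x) (suc y) }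
... | i , S , indep , size = i , outside ∷ S , lift , size
  where
  lift : IsIndependent (ColorEdge f i) (outside ∷ S)
  lift (suc x) (suc y) (there x∈S) (there y∈S) x≢y (_ , c≡i) =
    indep x y x∈S y∈S (λ x≡y → x≢y (cong suc x≡y)) ((λ x≡y → x≢y (cong suc x≡y)) , c≡i)

RamseyProp-mono : {m : Fin k → ℕ} {r : ℕ} → r ≤ n → RamseyProp k m r → RamseyProp k m n
RamseyProp-mono r≤n = go (≤⇒≤′ r≤n)
  where
  go : ∀ {m r n} → r ≤′ n → RamseyProp k m r → RamseyProp k m n
  go ≤′-refl        rp = rp
  go (≤′-step r≤′n) rp = RamseyProp-suc (go r≤′n rp)

least-≤ : {P : Pred ℕ 0ℓ} → Decidable₁ P → ∀ n → (∃ λ k → k ≤ n × P k) →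
          ∃ λ r → P r × r ≤ n × (∀ r′ → P r′ → r ≤ r′)
least-≤ P? n (k , k≤n , pk) with anyUpTo? P? n
... | no none = k , pk , k≤n , λ r′ pr′ → ≮⇒≥ λ r′<k → none (r′ , <-≤-trans r′<k k≤n , pr′)
least-≤ P? (suc n) _ | yes (j , s≤s j≤n , pj) with least-≤ P? n (j , j≤n , pj)
... | r , pr , r≤n , minimal = r , pr , m≤n⇒m≤1+n r≤n , minimal

Rbar-≤ : {m : Fin k → ℕ} → 1 ≤ n → RamseyProp k m n → ∃ λ r → IsRbar k m r × r ≤ n
Rbar-≤ {k = k} {n = n} {m = m} 1≤n rp
  with least-≤ (λ r → (1 ≤? r) ×-dec RamseyProp? k m r) n (n , ≤-refl , 1≤n , rp)
... | r , (1≤r , rpr) , r≤n , minimal =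
  r , (1≤r , rpr , λ r′ 1≤r′ rp′ → minimal r′ (1≤r′ , rp′)) , r≤n

Edge⇒≢ : (G : Graph n) → ∀ {x y} → Edge G x y → x ≢ y
Edge⇒≢ G {x} e refl with () ← trans (≡-sym e) (irrefl G x)

Edge-∖ : (G H : Graph n) → ∀ {x y} → Edge G x y → ¬ Edge H x y → Edge (G ∖ H) x y
Edge-∖ G H {x} {y} e ¬e rewrite e | ¬-not ¬e = refl

graphOf : (R : Fin n → Fin n → Set) → Decidable R → Symmetric R → Graph n
graphOf R R? R-sym = record
  { adj    = adj′
  ; sym    = λ x y → does-⇔ (mk⇔ flip flip) (¬? (x ≟ y) ×-dec R? x y) (¬? (y ≟ x) ×-dec R? y x)
  ; irrefl = λ x → dec-false (¬? (x ≟ x) ×-dec R? x x) λ (x≢x , _) → x≢x refl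
  }
  where
  adj′ : Fin _ → Fin _ → Bool
  adj′ x y = does (¬? (x ≟ y) ×-dec R? x y)
  flip : ∀ {x y} → x ≢ y × R x y → y ≢ x × R y x
  flip (x≢y , r) = ≢-sym x≢y , R-sym r

Edge-graphOf⇔ : (R : Fin n → Fin n → Set) (R? : Decidable R) (R-sym : Symmetric R) →
                ∀ {x y} → Edge (graphOf R R? R-sym) x y ⇔ (x ≢ y × R x y)
Edge-graphOf⇔ R R? R-sym {x} {y} =
  mk⇔ (witness (¬? (x ≟ y) ×-dec R? x y)) (dec-true (¬? (x ≟ y) ×-dec R? x y))
  where
  witness : {A : Set} (a? : Dec A) → does a? ≡ true → A
  witness (yes a) _ = a

colourClass-sym : (f : Coloring n k) (i : Fin k) → Symmetric (λ x y → col f x y ≡ i)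
colourClass-sym f i {x} {y} c≡i = trans (colSym f y x) c≡i

coColourClass-sym : (f : Coloring n k) (i : Fin k) → Symmetric (λ x y → col f x y ≢ i)
coColourClass-sym f i {x} {y} c≢i c≡i = c≢i (trans (colSym f x y) c≡i)

colourGraph : Coloring n k → Fin k → Graph n
colourGraph f i = graphOf (λ x y → col f x y ≡ i) (λ x y → col f x y ≟ i) (colourClass-sym f i)

coColourGraph : Coloring n k → Fin k → Graph n
coColourGraph f i =
  graphOf (λ x y → col f x y ≢ i) (λ x y → ¬? (col f x y ≟ i)) (coColourClass-sym f i)

Edge-colourGraph⇔ : (f : Coloring n k) (i : Fin k) → ∀ {x y} →
                    Edge (colourGraph f i) x y ⇔ ColorEdge f i x y
Edge-colourGraph⇔ f i =
  Edge-graphOf⇔ (λ x y → col f x y ≡ i) (λ x y → col f x y ≟ i) (colourClass-sym f i)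

Edge-coColourGraph⇔ : (f : Coloring n k) (i : Fin k) → ∀ {x y} →
                      Edge (coColourGraph f i) x y ⇔ (x ≢ y × col f x y ≢ i)
Edge-coColourGraph⇔ f i =
  Edge-graphOf⇔ (λ x y → col f x y ≢ i) (λ x y → ¬? (col f x y ≟ i)) (coColourClass-sym f i)

NestedRamseyGraphProp : ℕ → ℕ → ℕ → ℕ → Set
NestedRamseyGraphProp m₁ m₂ m₃ n =
  (G H : Graph n) → IsRamseyGraph m₃ m₂ G → IsRamseyGraph m₃ m₂ H →
  IsSubgraph H G → αAtLeast (Edge (G ∖ H)) m₁

NestedRamseyGraphProp⇒RamseyProp : ∀ m₁ m₂ m₃ →
  NestedRamseyGraphProp m₁ m₂ m₃ n → RamseyProp 3 (triple m₁ m₂ m₃) n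
NestedRamseyGraphProp⇒RamseyProp m₁ m₂ m₃ nested f
  with αAtLeast? (colorEdge? f 1F) m₂ | αAtLeast? (colorEdge? f 2F) m₃
... | yes α₁ | _      = 1F , α₁
... | no _   | yes α₂ = 2F , α₂
... | no ¬α₁ | no ¬α₂ = 0F , α-mono colour0⇒G∖H (nested G H (¬ωG , ¬αG) (¬ωH , ¬αH) H⊆G)
  where
  G = coColourGraph f 2F
  H = colourGraph f 1F
  G⇒ : ∀ {x y} → Edge G x y → x ≢ y × col f x y ≢ 2F
  G⇒ = Equivalence.to (Edge-coColourGraph⇔ f 2F)
  ⇒G : ∀ {x y} → x ≢ y × col f x y ≢ 2F → Edge G x y
  ⇒G = Equivalence.from (Edge-coColourGraph⇔ f 2F)
  H⇒ : ∀ {x y} → Edge H x y → ColorEdge f 1F x y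
  H⇒ = Equivalence.to (Edge-colourGraph⇔ f 1F)
  ⇒H : ∀ {x y} → ColorEdge f 1F x y → Edge H x y
  ⇒H = Equivalence.from (Edge-colourGraph⇔ f 1F)

  H⊆G : IsSubgraph H G
  H⊆G x y e with x≢y , c≡1 ← H⇒ e = ⇒G (x≢y , λ c≡2 → contradiction (trans (≡-sym c≡1) c≡2) λ ())
  ¬ωG : ¬ ωAtLeast (Edge G) m₃
  ¬ωG ω = ¬α₂ (ω⇒α-disjoint (λ x y e (_ , c≡2) → proj₂ (G⇒ e) c≡2) ω)
  ¬ωH : ¬ ωAtLeast (Edge H) m₃
  ¬ωH ω = ¬ωG (ω-mono H⊆G ω)
  ¬αH : ¬ αAtLeast (Edge H) m₂
  ¬αH α = ¬α₁ (α-mono (λ x y → ⇒H) α)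
  ¬αG : ¬ αAtLeast (Edge G) m₂
  ¬αG α = ¬αH (α-mono H⊆G α)
  colour0⇒G∖H : ∀ x y → ColorEdge f 0F x y → Edge (G ∖ H) x y
  colour0⇒G∖H x y (x≢y , c≡0) =
    Edge-∖ G H (⇒G (x≢y , λ c≡2 → contradiction (trans (≡-sym c≡0) c≡2) λ ()))
               (λ e → contradiction (trans (≡-sym c≡0) (proj₂ (H⇒ e))) λ ())

pairColour : Bool → Bool → Fin 3
pairColour true  _     = 1F
pairColour false true  = 0F
pairColour false false = 2F

pairColour≡1F : ∀ {h} g → h ≡ true → pairColour h g ≡ 1F
pairColour≡1F g refl = refl

pairColour≡0F : ∀ h g → g ∧ not h ≡ true → pairColour h g ≡ 0F
pairColour≡0F false true _ = refl

pairColour≢2F : ∀ h g → (h ≡ true → g ≡ true) → pairColour h g ≢ 2F → g ≡ true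
pairColour≢2F true  g     h⇒g _   = h⇒g refl
pairColour≢2F false true  _   _   = refl
pairColour≢2F false false _   ≢2F = ⊥-elim (≢2F refl)

pairColouring : Graph n → Graph n → Coloring n 3
pairColouring G H = record
  { col    = λ x y → pairColour (adj H x y) (adj G x y)
  ; colSym = λ x y → cong₂ pairColour (Graph.sym H x y) (Graph.sym G x y)
  }

RamseyProp⇒NestedRamseyGraphProp : ∀ m₁ m₂ m₃ →
  RamseyProp 3 (triple m₁ m₂ m₃) n → NestedRamseyGraphProp m₁ m₂ m₃ n
RamseyProp⇒NestedRamseyGraphProp m₁ m₂ m₃ rp G H (¬ωG , _) (_ , ¬αH) H⊆G with rp (pairColouring G H)
... | 0F , α₀ = α-mono (λ x y e → Edge⇒≢ (G ∖ H) e , pairColour≡0F (adj H x y) (adj G x y) e) α₀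
... | 1F , α₁ = ⊥-elim (¬αH (α-mono (λ x y e → Edge⇒≢ H e , pairColour≡1F (adj G x y) e) α₁))
... | 2F , α₂ = ⊥-elim (¬ωG (α⇒ω-covering covering α₂))
  where
  covering : ∀ x y → x ≢ y → ¬ ColorEdge (pairColouring G H) 2F x y → Edge G x y
  covering x y x≢y ¬c₂ = pairColour≢2F (adj H x y) (adj G x y) (H⊆G x y) (λ c≡2 → ¬c₂ (x≢y , c≡2))

lemma3p3 : (m₁ m₂ m₃ n : ℕ) → 2 < m₁ → 2 < m₂ → 2 < m₃ → 2 < n →
    (∃ λ r → IsRbar 3 (triple m₁ m₂ m₃) r × r ≤ n)
    ⇔ ((G H : Graph n) → IsRamseyGraph m₃ m₂ G → IsRamseyGraph m₃ m₂ H →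
    IsSubgraph H G → αAtLeast (Edge (G ∖ H)) m₁)
lemma3p3 m₁ m₂ m₃ n _ _ _ 2<n = mk⇔
  (λ (r , (_ , rp , _) , r≤n) → RamseyProp⇒NestedRamseyGraphProp m₁ m₂ m₃ (RamseyProp-mono r≤n rp))
  (λ nested → Rbar-≤ (≤-trans (s≤s z≤n) 2<n) (NestedRamseyGraphProp⇒RamseyProp m₁ m₂ m₃ nested))
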